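{- Let $\mathcal{G}=(V,E)$ be a hypergraph with $|V|=n$ in which every hyperedge contains at most $f$ nodes. Let $\beta = 17$, $\alpha = 1+36 f^2\beta^2$, $L=\lceil f\log_\beta n\rceil+1$, and let $\ell: V\to\{0,1,\ldots,L\}$ be any level assignment. For a hyperedge $e$ put $\ell(e)=\max_{v\in e}\ell(v)$ and $w(e)=\beta^{ -\ell(e)}$, and for a node $v$ put $W_v=\sum_{e\in E: v\in e} w(e)$. Suppose that every node $v$ with $\ell(v)>0$ satisfies $1/(\alpha\beta^2) < W_v < 1$, and every node $v$ with $\ell(v)=0$ satisfies $0\le W_v\le 1/\beta^2$. Then the weights $\{w(e)\}_{e\in E}$ form an $f\alpha\beta^2$-approximate maximum fractional matching of $\mathcal{G}$, and the set of nodes $\{v: \ell(v)\in\{1,\ldots,L\}\}$ forms an $f\alpha\beta^2$-approximate minimum vertex cover of $\mathcal{G}$.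
   Context: A fractional matching assigns weights $w(e)\ge 0$ to hyperedges with $\sum_{e\ni v} w(e)\le 1$ for every node $v$; its size is $\sum_e w(e)$. A $c$-approximate maximum fractional matching has size at least $1/c$ times the maximum fractional matching size; a $c$-approximate minimum vertex cover is a vertex cover (set of nodes meeting every hyperedge) of size at most $c$ times the minimum. -}

module Defs where

open import Data.Nat as ℕ using (ℕ; zero; suc; _⊔_; _^_)
open import Data.Nat.Properties using (m^n≢0)
open import Data.Integer using (+_)
open import Data.Rational as ℚ using (ℚ; 0ℚ; _/_; _+_; _*_; _≤_)
open import Data.Fin using (Fin; zero; suc; toℕ)
open import Data.Fin.Subset using (Subset; _∈_; ∣_∣; Nonempty)
open import Data.Fin.Subset.Properties using (_∈?_)
open import Data.Vec using (tabulate)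
open import Data.Bool using (true; false)
open import Relation.Nullary using (yes; no; ¬_)
open import Relation.Binary.PropositionalEquality using (_≡_)

β : ℕ
β = 17

α : ℕ → ℕ
α f = 1 ℕ.+ 36 ℕ.* f ℕ.* f ℕ.* β ℕ.* β

approxFactor : ℕ → ℕ
approxFactor f = f ℕ.* α f ℕ.* β ℕ.* β

invPow : ℕ → ℚ
invPow k = _/_ (+ 1) (17 ^ k) {{m^n≢0 17 k}}

inv : (d : ℕ) → .{{ℕ.NonZero d}} → ℚ
inv d = (+ 1) / d

Σ[_] : ∀ {m} → (Fin m → ℚ) → ℚ
Σ[_] {zero}  g = 0ℚ
Σ[_] {suc m} g = g zero + Σ[ (λ i → g (suc i)) ]

maxFin : ∀ {n} → (Fin n → ℕ) → ℕ
maxFin {zero}  g = 0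
maxFin {suc n} g = g zero ⊔ maxFin (λ i → g (suc i))

-- A hypergraph on node set Fin n with m hyperedges, each a (set) Subset n.
-- sum over hyperedges containing v
ΣAt : ∀ {n m} → (Fin m → Subset n) → (Fin m → ℚ) → Fin n → ℚ
ΣAt E y v = Σ[ (λ i → ind (v ∈? E i) (y i)) ]
  where
  ind : ∀ {P : Set} → Relation.Nullary.Dec P → ℚ → ℚ
  ind (yes _) q = q
  ind (no _)  _ = 0ℚ

IsFractionalMatching : ∀ {n m} → (Fin m → Subset n) → (Fin m → ℚ) → Set
IsFractionalMatching {n} {m} E y =
  ((i : Fin m) → 0ℚ ≤ y i) Data.Product.× ((v : Fin n) → ΣAt E y v ≤ ℚ.1ℚ)
  where import Data.Product

size : ∀ {m} → (Fin m → ℚ) → ℚ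
size y = Σ[ y ]

-- c-approximate maximum fractional matching (size ≥ (1/c)·OPT, i.e. c·size ≥ size of every fractional matching)
IsApproxMaxFracMatching : ∀ {n m} → ℕ → (Fin m → Subset n) → (Fin m → ℚ) → Set
IsApproxMaxFracMatching {n} {m} c E y =
  IsFractionalMatching E y Data.Product.×
  ((z : Fin m → ℚ) → IsFractionalMatching E z → size z ≤ (+ c / 1) * size y)
  where import Data.Product

IsVertexCover : ∀ {n m} → (Fin m → Subset n) → Subset n → Set
IsVertexCover {n} {m} E C = (i : Fin m) → Data.Product.∃ λ v → v ∈ E i Data.Product.× v ∈ C
  where import Data.Product

IsApproxMinVertexCover : ∀ {n m} → ℕ → (Fin m → Subset n) → Subset n → Set
IsApproxMinVertexCover {n} {m} c E C =
  IsVertexCover E C Data.Product.×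
  ((D : Subset n) → IsVertexCover E D → ∣ C ∣ ℕ.≤ c ℕ.* ∣ D ∣)
  where import Data.Product

-- L = ⌈ f log_β n ⌉ + 1, characterised exactly: ⌈ f log_β n ⌉ is the least k with n^f ≤ β^k
IsCeilFLog : ℕ → ℕ → ℕ → Set
IsCeilFLog n f k = (n ^ f ℕ.≤ β ^ k) Data.Product.× (∀ j → n ^ f ℕ.≤ β ^ j → k ℕ.≤ j)
  where import Data.Product

edgeLevel : ∀ {n L} → (Fin n → Fin (suc L)) → Subset n → ℕ
edgeLevel lv e = maxFin (λ v → lvAt (v ∈? e) v)
  where
  lvAt : ∀ {P : Set} → Relation.Nullary.Dec P → _ → ℕ
  lvAt (yes _) v = toℕ (lv v)
  lvAt (no _)  _ = 0

weight : ∀ {n m L} → (Fin m → Subset n) → (Fin n → Fin (suc L)) → Fin m → ℚ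
weight E lv i = invPow (edgeLevel lv (E i))

positiveLevelNodes : ∀ {n L} → (Fin n → Fin (suc L)) → Subset n
positiveLevelNodes lv = tabulate λ v → pos (lv v)
  where
  pos : ∀ {L} → Fin (suc L) → Data.Bool.Bool
  pos zero    = false
  pos (suc _) = true

-- The weights form a fractional matching because every load W_v is at most 1.
-- A hyperedge all of whose nodes have level 0 would have weight β⁰ = 1, so each of its
-- (nonempty set of) nodes would carry load ≥ 1 > β⁻²; hence the positive-level nodes C
-- form a vertex cover. Every v ∈ C has W_v > 1/(αβ²), so by double counting
--   |C| ≤ αβ² Σ_v W_v = αβ² Σ_e |e| w(e) ≤ fαβ² Σ_e w(e).
-- Weak LP duality (every fractional matching is at most every vertex cover) turns this
-- one inequality into both approximation guarantees.
module Submission where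

open import Defs
open import Data.Nat as ℕ using (ℕ; suc)
open import Data.Rational as ℚ using (ℚ; _<_; _≤_)
open import Data.Fin using (Fin; zero; suc)
open import Data.Fin.Subset using (Subset; ∣_∣; Nonempty)
open import Data.Product using (_×_; ∃)
open import Relation.Binary.PropositionalEquality using (_≡_; _≢_)

open import Algebra.Bundles using (CommutativeRing)
import Data.Nat.Properties as ℕ
import Data.Nat.Coprimality as Coprime
import Data.Integer as ℤ
import Data.Integer.Properties as ℤ
open import Data.Rational using (0ℚ; 1ℚ; _+_; _*_; _/_; mkℚ)
import Data.Rational.Properties as ℚ
open import Data.Fin.Subset using (_∈_)
open import Data.Fin.Subset.Properties using (_∈?_)
open import Data.Fin using (toℕ)
import Data.Fin.Properties as Fin
open import Data.Vec using ([]; _∷_; here; there)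
open import Data.Bool using (true; false)
open import Data.Product using (Σ; _,_; proj₁; proj₂)
open import Data.Empty using (⊥-elim)
open import Relation.Nullary using (Dec; yes; no)
open import Relation.Nullary.Decidable using (_×-dec_; map′)
open import Relation.Binary.PropositionalEquality
  using (refl; sym; trans; cong; cong₂; subst; subst₂; module ≡-Reasoning)

open import Algebra.Properties.Semiring.Sum
  (CommutativeRing.semiring ℚ.+-*-commutativeRing)
  using (sum; sum-cong-≗; sum-replicate-zero; ∑-comm; *-distribˡ-sum; *-distribʳ-sum)

Σ≡sum : ∀ {m} (g : Fin m → ℚ) → Σ[ g ] ≡ sum g
Σ≡sum {ℕ.zero}  g = refl
Σ≡sum {suc m} g = cong (g zero +_) (Σ≡sum (λ i → g (suc i)))

Σ-cong : ∀ {m} {g h : Fin m → ℚ} → (∀ i → g i ≡ h i) → Σ[ g ] ≡ Σ[ h ]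
Σ-cong {ℕ.zero}  g≗h = refl
Σ-cong {suc m} g≗h = cong₂ _+_ (g≗h zero) (Σ-cong (λ i → g≗h (suc i)))

Σ-mono-≤ : ∀ {m} {g h : Fin m → ℚ} → (∀ i → g i ≤ h i) → Σ[ g ] ≤ Σ[ h ]
Σ-mono-≤ {ℕ.zero}  g≤h = ℚ.≤-refl
Σ-mono-≤ {suc m} g≤h = ℚ.+-mono-≤ (g≤h zero) (Σ-mono-≤ (λ i → g≤h (suc i)))

Σ-nonNeg : ∀ {m} {g : Fin m → ℚ} → (∀ i → 0ℚ ≤ g i) → 0ℚ ≤ Σ[ g ]
Σ-nonNeg {ℕ.zero}  g≥0 = ℚ.≤-refl
Σ-nonNeg {suc m} g≥0 = ℚ.+-mono-≤ (g≥0 zero) (Σ-nonNeg (λ i → g≥0 (suc i)))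

term≤Σ : ∀ {m} {g : Fin m → ℚ} → (∀ i → 0ℚ ≤ g i) → ∀ j → g j ≤ Σ[ g ]
term≤Σ {suc m} {g} g≥0 zero =
  subst (_≤ g zero + Σ[ (λ i → g (suc i)) ]) (ℚ.+-identityʳ (g zero))
    (ℚ.+-monoʳ-≤ (g zero) (Σ-nonNeg (λ i → g≥0 (suc i))))
term≤Σ {suc m} {g} g≥0 (suc j) =
  subst (_≤ g zero + Σ[ (λ i → g (suc i)) ]) (ℚ.+-identityˡ (g (suc j)))
    (ℚ.+-mono-≤ (g≥0 zero) (term≤Σ (λ i → g≥0 (suc i)) j))

Σ-comm : ∀ {m k} (h : Fin m → Fin k → ℚ) →
         Σ[ (λ i → Σ[ h i ]) ] ≡ Σ[ (λ j → Σ[ (λ i → h i j) ]) ]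
Σ-comm h = begin
  Σ[ (λ i → Σ[ h i ]) ]             ≡⟨ ΣΣ≡sumsum h ⟩
  sum (λ i → sum (h i))             ≡⟨ ∑-comm h ⟩
  sum (λ j → sum (λ i → h i j))     ≡⟨ ΣΣ≡sumsum (λ j i → h i j) ⟨
  Σ[ (λ j → Σ[ (λ i → h i j) ]) ]   ∎
  where
  open ≡-Reasoning
  ΣΣ≡sumsum : ∀ {a b} (t : Fin a → Fin b → ℚ) → Σ[ (λ i → Σ[ t i ]) ] ≡ sum (λ i → sum (t i))
  ΣΣ≡sumsum t = trans (Σ≡sum (λ i → Σ[ t i ])) (sum-cong-≗ (λ i → Σ≡sum (t i)))

*-distribˡ-Σ : ∀ {m} (c : ℚ) (g : Fin m → ℚ) → c * Σ[ g ] ≡ Σ[ (λ i → c * g i) ]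
*-distribˡ-Σ c g =
  trans (cong (c *_) (Σ≡sum g)) (trans (*-distribˡ-sum c g) (sym (Σ≡sum (λ i → c * g i))))

*-distribʳ-Σ : ∀ {m} (c : ℚ) (g : Fin m → ℚ) → Σ[ g ] * c ≡ Σ[ (λ i → g i * c) ]
*-distribʳ-Σ c g =
  trans (cong (_* c) (Σ≡sum g)) (trans (*-distribʳ-sum c g) (sym (Σ≡sum (λ i → g i * c))))

infixl 6 _when_

_when_ : ∀ {P : Set} → ℚ → Dec P → ℚ
q when yes _ = q
q when no  _ = 0ℚ

when-yes : ∀ {P : Set} (d : Dec P) q → P → q when d ≡ q
when-yes (yes _) q p = refl
when-yes (no ¬p) q p = ⊥-elim (¬p p)

when-nonNeg : ∀ {P : Set} (d : Dec P) {q} → 0ℚ ≤ q → 0ℚ ≤ q when d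
when-nonNeg (yes _) q≥0 = q≥0
when-nonNeg (no _)  q≥0 = ℚ.≤-refl

when-mono-≤ : ∀ {P : Set} (d : Dec P) {p q} → p ≤ q → p when d ≤ q when d
when-mono-≤ (yes _) p≤q = p≤q
when-mono-≤ (no _)  p≤q = ℚ.≤-refl

when-≤ : ∀ {P : Set} (d : Dec P) {q} → 0ℚ ≤ q → q when d ≤ q
when-≤ (yes _) q≥0 = ℚ.≤-refl
when-≤ (no _)  q≥0 = q≥0

when-Σ : ∀ {P : Set} (d : Dec P) {m} (g : Fin m → ℚ) → Σ[ g ] when d ≡ Σ[ (λ i → g i when d) ]
when-Σ (yes _) g = refl
when-Σ (no _) {m} g = sym (trans (Σ≡sum {m} (λ _ → 0ℚ)) (sum-replicate-zero m))

when-*ˡ : ∀ {P : Set} (d : Dec P) q → q when d ≡ (1ℚ when d) * q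
when-*ˡ (yes _) q = sym (ℚ.*-identityˡ q)
when-*ˡ (no _)  q = sym (ℚ.*-zeroˡ q)

when-map′ : ∀ {P Q : Set} (f : P → Q) (g : Q → P) (d : Dec P) q → q when map′ f g d ≡ q when d
when-map′ f g (yes _) q = refl
when-map′ f g (no _)  q = refl

fromℕ : ℕ → ℚ
fromℕ k = ℤ.+ k / 1

fromℕ≡mkℚ : ∀ k → fromℕ k ≡ mkℚ (ℤ.+ k) 0 (Coprime.sym (Coprime.1-coprimeTo k))
fromℕ≡mkℚ k = ℚ.↥p/↧p≡p (mkℚ (ℤ.+ k) 0 (Coprime.sym (Coprime.1-coprimeTo k)))

fromℕ-+ : ∀ a b → fromℕ (a ℕ.+ b) ≡ fromℕ a + fromℕ b
fromℕ-+ a b = trans (ℚ./-cong numerators refl) (sym (cong₂ _+_ (fromℕ≡mkℚ a) (fromℕ≡mkℚ b)))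
  where
  numerators : ℤ.+ (a ℕ.+ b) ≡ ℤ.+ a ℤ.* ℤ.+ 1 ℤ.+ ℤ.+ b ℤ.* ℤ.+ 1
  numerators = trans (ℤ.pos-+ a b)
    (sym (cong₂ ℤ._+_ (ℤ.*-identityʳ (ℤ.+ a)) (ℤ.*-identityʳ (ℤ.+ b))))

fromℕ-* : ∀ a b → fromℕ (a ℕ.* b) ≡ fromℕ a * fromℕ b
fromℕ-* a b = trans (ℚ./-cong (ℤ.pos-* a b) refl) (sym (cong₂ _*_ (fromℕ≡mkℚ a) (fromℕ≡mkℚ b)))

fromℕ-mono-≤ : ∀ {a b} → a ℕ.≤ b → fromℕ a ≤ fromℕ b
fromℕ-mono-≤ {a} {b} a≤b = subst₂ _≤_ (sym (fromℕ≡mkℚ a)) (sym (fromℕ≡mkℚ b))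
  (ℚ.*≤* (subst₂ ℤ._≤_ (sym (ℤ.*-identityʳ (ℤ.+ a))) (sym (ℤ.*-identityʳ (ℤ.+ b))) (ℤ.+≤+ a≤b)))

fromℕ-cancel-≤ : ∀ {a b} → fromℕ a ≤ fromℕ b → a ℕ.≤ b
fromℕ-cancel-≤ {a} {b} fa≤fb with subst₂ _≤_ (fromℕ≡mkℚ a) (fromℕ≡mkℚ b) fa≤fb
... | ℚ.*≤* a*1≤b*1 =
  ℤ.drop‿+≤+ (subst₂ ℤ._≤_ (ℤ.*-identityʳ (ℤ.+ a)) (ℤ.*-identityʳ (ℤ.+ b)) a*1≤b*1)

fromℕ-nonNeg : ∀ k → 0ℚ ≤ fromℕ k
fromℕ-nonNeg k = fromℕ-mono-≤ (ℕ.z≤n {k})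

fromℕ*inv≡1 : ∀ d .{{_ : ℕ.NonZero d}} → fromℕ d * inv d ≡ 1ℚ
fromℕ*inv≡1 (suc d) =
  trans (cong₂ _*_ (fromℕ≡mkℚ (suc d)) (ℚ.↥p/↧p≡p (mkℚ (ℤ.+ 1) d (Coprime.1-coprimeTo (suc d)))))
        (ℚ.*-inverseʳ (mkℚ (ℤ.+ suc d) 0 (Coprime.sym (Coprime.1-coprimeTo (suc d)))))

∣p∣≡Σ : ∀ {n} (p : Subset n) → fromℕ ∣ p ∣ ≡ Σ[ (λ v → 1ℚ when (v ∈? p)) ]
∣p∣≡Σ-tail : ∀ {n b} (p : Subset n) → fromℕ ∣ p ∣ ≡ Σ[ (λ v → 1ℚ when (suc v ∈? (b ∷ p))) ]

∣p∣≡Σ []          = refl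
∣p∣≡Σ (true ∷ p)  = trans (fromℕ-+ 1 ∣ p ∣) (cong (1ℚ +_) (∣p∣≡Σ-tail p))
∣p∣≡Σ (false ∷ p) = trans (sym (ℚ.+-identityˡ (fromℕ ∣ p ∣))) (cong (0ℚ +_) (∣p∣≡Σ-tail p))

∣p∣≡Σ-tail p = trans (∣p∣≡Σ p) (Σ-cong (λ v → sym (when-map′ there _ (v ∈? p) 1ℚ)))

ΣAt≡Σ-when : ∀ {n m} (E : Fin m → Subset n) (y : Fin m → ℚ) v →
             ΣAt E y v ≡ Σ[ (λ i → y i when (v ∈? E i)) ]
ΣAt≡Σ-when {m = ℕ.zero}  E y v = refl
ΣAt≡Σ-when {m = suc m} E y v with v ∈? E zero
... | yes _ = cong (y zero +_)  (ΣAt≡Σ-when (λ i → E (suc i)) (λ i → y (suc i)) v)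
... | no _  = cong (0ℚ +_)      (ΣAt≡Σ-when (λ i → E (suc i)) (λ i → y (suc i)) v)

∣C∣≤A*Σ : ∀ {n} (A : ℕ) .{{_ : ℕ.NonZero A}} (C : Subset n) {W : Fin n → ℚ} →
          (∀ v → 0ℚ ≤ W v) → (∀ {v} → v ∈ C → inv A < W v) → fromℕ ∣ C ∣ ≤ fromℕ A * Σ[ W ]
∣C∣≤A*Σ A C {W} W≥0 W>1/A = begin
  fromℕ ∣ C ∣                                  ≡⟨ ∣p∣≡Σ C ⟩
  Σ[ (λ v → 1ℚ when (v ∈? C)) ]                ≤⟨ Σ-mono-≤ (λ v → 1≤A*W (v ∈? C)) ⟩
  Σ[ (λ v → fromℕ A * (W v when (v ∈? C))) ]   ≡⟨ *-distribˡ-Σ (fromℕ A) (λ v → W v when (v ∈? C)) ⟨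
  fromℕ A * Σ[ (λ v → W v when (v ∈? C)) ]     ≤⟨ ℚ.*-monoˡ-≤-nonNeg (fromℕ A) {{ℚ.nonNegative (fromℕ-nonNeg A)}}
                                                    (Σ-mono-≤ (λ v → when-≤ (v ∈? C) (W≥0 v))) ⟩
  fromℕ A * Σ[ W ]                             ∎
  where
  open ℚ.≤-Reasoning
  1≤A*W : ∀ {v} (v∈?C : Dec (v ∈ C)) → 1ℚ when v∈?C ≤ fromℕ A * (W v when v∈?C)
  1≤A*W {v} (yes v∈C) = subst (_≤ fromℕ A * W v) (fromℕ*inv≡1 A)
    (ℚ.*-monoˡ-≤-nonNeg (fromℕ A) {{ℚ.nonNegative (fromℕ-nonNeg A)}} (ℚ.<⇒≤ (W>1/A v∈C)))
  1≤A*W (no _)    = ℚ.≤-reflexive (sym (ℚ.*-zeroʳ (fromℕ A)))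

module _ {n m} (E : Fin m → Subset n) {y : Fin m → ℚ} (y≥0 : ∀ i → 0ℚ ≤ y i) where

  ΣAt-nonNeg : ∀ v → 0ℚ ≤ ΣAt E y v
  ΣAt-nonNeg v = subst (0ℚ ≤_) (sym (ΣAt≡Σ-when E y v))
    (Σ-nonNeg (λ i → when-nonNeg (v ∈? E i) (y≥0 i)))

  weight≤ΣAt : ∀ {i v} → v ∈ E i → y i ≤ ΣAt E y v
  weight≤ΣAt {i} {v} v∈e = subst₂ _≤_ (when-yes (v ∈? E i) (y i) v∈e) (sym (ΣAt≡Σ-when E y v))
    (term≤Σ (λ j → when-nonNeg (v ∈? E j) (y≥0 j)) i)

  Σ-ΣAt≡Σ-∣E∣* : Σ[ ΣAt E y ] ≡ Σ[ (λ i → fromℕ ∣ E i ∣ * y i) ]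
  Σ-ΣAt≡Σ-∣E∣* = begin
    Σ[ ΣAt E y ]                                      ≡⟨ Σ-cong (ΣAt≡Σ-when E y) ⟩
    Σ[ (λ v → Σ[ (λ i → y i when (v ∈? E i)) ]) ]     ≡⟨ Σ-comm (λ v i → y i when (v ∈? E i)) ⟩
    Σ[ (λ i → Σ[ (λ v → y i when (v ∈? E i)) ]) ]     ≡⟨ Σ-cong edge ⟩
    Σ[ (λ i → fromℕ ∣ E i ∣ * y i) ]                  ∎
    where
    open ≡-Reasoning
    edge : ∀ i → Σ[ (λ v → y i when (v ∈? E i)) ] ≡ fromℕ ∣ E i ∣ * y i
    edge i = begin
      Σ[ (λ v → y i when (v ∈? E i)) ]          ≡⟨ Σ-cong (λ v → when-*ˡ (v ∈? E i) (y i)) ⟩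
      Σ[ (λ v → (1ℚ when (v ∈? E i)) * y i) ]   ≡⟨ *-distribʳ-Σ (y i) (λ v → 1ℚ when (v ∈? E i)) ⟨
      Σ[ (λ v → 1ℚ when (v ∈? E i)) ] * y i     ≡⟨ cong (_* y i) (∣p∣≡Σ (E i)) ⟨
      fromℕ ∣ E i ∣ * y i                        ∎

  Σ-ΣAt≤ : ∀ {f} → (∀ i → ∣ E i ∣ ℕ.≤ f) → Σ[ ΣAt E y ] ≤ fromℕ f * size y
  Σ-ΣAt≤ {f} ∣E∣≤f = begin
    Σ[ ΣAt E y ]                       ≡⟨ Σ-ΣAt≡Σ-∣E∣* ⟩
    Σ[ (λ i → fromℕ ∣ E i ∣ * y i) ]   ≤⟨ Σ-mono-≤ (λ i → ℚ.*-monoʳ-≤-nonNeg (y i) {{ℚ.nonNegative (y≥0 i)}}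
                                                           (fromℕ-mono-≤ (∣E∣≤f i))) ⟩
    Σ[ (λ i → fromℕ f * y i) ]         ≡⟨ *-distribˡ-Σ (fromℕ f) y ⟨
    fromℕ f * size y                   ∎
    where open ℚ.≤-Reasoning

  ∣C∣≤f*A*size : ∀ {f} → (∀ i → ∣ E i ∣ ℕ.≤ f) → ∀ A .{{_ : ℕ.NonZero A}} (C : Subset n) →
                 (∀ {v} → v ∈ C → inv A < ΣAt E y v) → fromℕ ∣ C ∣ ≤ fromℕ (f ℕ.* A) * size y
  ∣C∣≤f*A*size {f} ∣E∣≤f A C C-loaded = begin
    fromℕ ∣ C ∣                    ≤⟨ ∣C∣≤A*Σ A C ΣAt-nonNeg C-loaded ⟩
    fromℕ A * Σ[ ΣAt E y ]         ≤⟨ ℚ.*-monoˡ-≤-nonNeg (fromℕ A) {{ℚ.nonNegative (fromℕ-nonNeg A)}}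
                                        (Σ-ΣAt≤ ∣E∣≤f) ⟩
    fromℕ A * (fromℕ f * size y)   ≡⟨ ℚ.*-assoc (fromℕ A) (fromℕ f) (size y) ⟨
    fromℕ A * fromℕ f * size y     ≡⟨ cong (_* size y) (trans (fromℕ-* f A) (ℚ.*-comm (fromℕ f) (fromℕ A))) ⟨
    fromℕ (f ℕ.* A) * size y       ∎
    where open ℚ.≤-Reasoning

size≤∣cover∣ : ∀ {n m} {E : Fin m → Subset n} {z : Fin m → ℚ} → IsFractionalMatching E z →
               ∀ {D} → IsVertexCover E D → size z ≤ fromℕ ∣ D ∣
size≤∣cover∣ {E = E} {z} (z≥0 , load≤1) {D} covers = begin
  Σ[ z ]                                                      ≤⟨ Σ-mono-≤ z≤loadOnD ⟩
  Σ[ (λ i → Σ[ (λ v → z i when (v ∈? E i) when (v ∈? D)) ]) ] ≡⟨ Σ-comm (λ i v → z i when (v ∈? E i) when (v ∈? D)) ⟩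
  Σ[ (λ v → Σ[ (λ i → z i when (v ∈? E i) when (v ∈? D)) ]) ] ≡⟨ Σ-cong (λ v → sym (when-Σ (v ∈? D) (λ i → z i when (v ∈? E i)))) ⟩
  Σ[ (λ v → Σ[ (λ i → z i when (v ∈? E i)) ] when (v ∈? D)) ] ≡⟨ Σ-cong (λ v → cong (_when (v ∈? D)) (ΣAt≡Σ-when E z v)) ⟨
  Σ[ (λ v → ΣAt E z v when (v ∈? D)) ]                        ≤⟨ Σ-mono-≤ (λ v → when-mono-≤ (v ∈? D) (load≤1 v)) ⟩
  Σ[ (λ v → 1ℚ when (v ∈? D)) ]                               ≡⟨ ∣p∣≡Σ D ⟨
  fromℕ ∣ D ∣                                                 ∎
  where
  open ℚ.≤-Reasoning
  z≤loadOnD : ∀ i → z i ≤ Σ[ (λ v → z i when (v ∈? E i) when (v ∈? D)) ]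
  z≤loadOnD i with covers i
  ... | v , v∈e , v∈D = subst (_≤ _)
    (trans (when-yes (v ∈? D) _ v∈D) (when-yes (v ∈? E i) (z i) v∈e))
    (term≤Σ (λ u → when-nonNeg (u ∈? D) (when-nonNeg (u ∈? E i) (z≥0 i))) v)

approximate-by-duality : ∀ {n m} (c : ℕ) (E : Fin m → Subset n) {y : Fin m → ℚ} {C : Subset n} →
  IsFractionalMatching E y → IsVertexCover E C → fromℕ ∣ C ∣ ≤ fromℕ c * size y →
  IsApproxMaxFracMatching c E y × IsApproxMinVertexCover c E C
approximate-by-duality c E {y} {C} y-matching C-covers ∣C∣≤c*y =
    (y-matching , λ z z-matching → ℚ.≤-trans (size≤∣cover∣ z-matching C-covers) ∣C∣≤c*y)
  , (C-covers , λ D D-covers → fromℕ-cancel-≤ (begin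
      fromℕ ∣ C ∣          ≤⟨ ∣C∣≤c*y ⟩
      fromℕ c * size y     ≤⟨ ℚ.*-monoˡ-≤-nonNeg (fromℕ c) {{ℚ.nonNegative (fromℕ-nonNeg c)}}
                                (size≤∣cover∣ y-matching D-covers) ⟩
      fromℕ c * fromℕ ∣ D ∣ ≡⟨ fromℕ-* c ∣ D ∣ ⟨
      fromℕ (c ℕ.* ∣ D ∣)  ∎))
  where open ℚ.≤-Reasoning

maxFin≡0 : ∀ {k} (g : Fin k → ℕ) → (∀ i → g i ≡ 0) → maxFin g ≡ 0
maxFin≡0 {ℕ.zero}  g g≡0 = refl
maxFin≡0 {suc k} g g≡0 rewrite g≡0 zero = maxFin≡0 (λ i → g (suc i)) (λ i → g≡0 (suc i))

module _ {n L : ℕ} (lv : Fin n → Fin (suc L)) where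

  -- `edgeLevel` maxes a function local to its definition; `_ , refl` exposes it so that its
  -- values can be inspected by `with`.
  edgeLevel≡maxFin : (e : Subset n) → Σ (Fin n → ℕ) (λ g → edgeLevel lv e ≡ maxFin g)
  edgeLevel≡maxFin e = _ , refl

  edgeLevel≡0 : (e : Subset n) → (∀ {v} → v ∈ e → lv v ≡ zero) → edgeLevel lv e ≡ 0
  edgeLevel≡0 e e⊆level0 = trans (proj₂ (edgeLevel≡maxFin e)) (maxFin≡0 _ term≡0)
    where
    term≡0 : ∀ v → proj₁ (edgeLevel≡maxFin e) v ≡ 0
    term≡0 v with v ∈? e
    ... | yes v∈e = cong toℕ (e⊆level0 v∈e)
    ... | no _    = refl

∈positiveLevelNodes : ∀ {n L} (lv : Fin n → Fin (suc L)) {v} → lv v ≢ zero → v ∈ positiveLevelNodes lv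
∈positiveLevelNodes lv {zero} lv≢0 with lv zero
... | zero  = ⊥-elim (lv≢0 refl)
... | suc _ = here
∈positiveLevelNodes lv {suc v} lv≢0 = there (∈positiveLevelNodes (λ u → lv (suc u)) lv≢0)

∈positiveLevelNodes⁻ : ∀ {n L} (lv : Fin n → Fin (suc L)) {v} → v ∈ positiveLevelNodes lv → lv v ≢ zero
∈positiveLevelNodes⁻ lv {zero} v∈C lv≡0 with lv zero
∈positiveLevelNodes⁻ lv {zero} () refl | zero
∈positiveLevelNodes⁻ lv {suc v} (there v∈C) = ∈positiveLevelNodes⁻ (λ u → lv (suc u)) v∈C

invPow-nonNeg : ∀ k → 0ℚ ≤ invPow k
invPow-nonNeg k = ℚ.nonNegative⁻¹ (invPow k) {{ℚ.normalize-nonNeg 1 (17 ℕ.^ k) {{ℕ.m^n≢0 17 k}}}}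

positiveLevelNodes-cover : ∀ {n m L} (E : Fin m → Subset n) (lv : Fin n → Fin (suc L)) →
  (∀ i → Nonempty (E i)) → (∀ v → lv v ≡ zero → ΣAt E (weight E lv) v < 1ℚ) →
  IsVertexCover E (positiveLevelNodes lv)
positiveLevelNodes-cover E lv nonempty level0-underloaded i
  with Fin.any? (λ v → (v ∈? E i) ×-dec (v ∈? positiveLevelNodes lv))
... | yes covered  = covered
... | no uncovered = ⊥-elim (ℚ.<-irrefl refl (ℚ.<-≤-trans (level0-underloaded v (level0 v∈e)) 1≤load))
  where
  level0 : ∀ {u} → u ∈ E i → lv u ≡ zero
  level0 {u} u∈e with lv u Fin.≟ zero
  ... | yes lv≡0 = lv≡0
  ... | no lv≢0  = ⊥-elim (uncovered (u , u∈e , ∈positiveLevelNodes lv lv≢0))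
  v   = proj₁ (nonempty i)
  v∈e = proj₂ (nonempty i)
  1≤load : 1ℚ ≤ ΣAt E (weight E lv) v
  1≤load = subst (_≤ ΣAt E (weight E lv) v) (cong invPow (edgeLevel≡0 lv (E i) level0))
    (weight≤ΣAt E (λ j → invPow-nonNeg (edgeLevel lv (E j))) v∈e)

invPow2<1 : invPow 2 < 1ℚ
invPow2<1 = ℚ.*<* (ℤ.+<+ (ℕ.s≤s (ℕ.s≤s ℕ.z≤n)))

approxFactor≡f*αβ² : ∀ f → approxFactor f ≡ f ℕ.* (α f ℕ.* β ℕ.* β)
approxFactor≡f*αβ² f =
  trans (cong (ℕ._* β) (ℕ.*-assoc f (α f) β)) (ℕ.*-assoc f (α f ℕ.* β) β)

-- Neither the distinctness of the hyperedges nor the value of L is needed.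
theorem2 : (n m f : ℕ) (E : Fin m → Subset n)
    → (∀ i j → E i ≡ E j → i ≡ j)
    → (∀ i → Nonempty (E i))
    → (∀ i → ∣ E i ∣ ℕ.≤ f)
    → (L : ℕ) → (∃ λ k → IsCeilFLog n f k × L ≡ suc k)
    → (lv : Fin n → Fin (suc L))
    → (∀ v → lv v ≢ zero
         → inv (α f ℕ.* β ℕ.* β) < ΣAt E (weight E lv) v × ΣAt E (weight E lv) v < ℚ.1ℚ)
    → (∀ v → lv v ≡ zero → ΣAt E (weight E lv) v ≤ invPow 2)
    → IsApproxMaxFracMatching (approxFactor f) E (weight E lv)
      × IsApproxMinVertexCover (approxFactor f) E (positiveLevelNodes lv)
theorem2 n m f E _ nonempty ∣E∣≤f L _ lv positive-level level0 =
  approximate-by-duality (approxFactor f) E (y≥0 , W≤1) covers ∣C∣≤c*y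
  where
  y : Fin m → ℚ
  y = weight E lv
  W : Fin n → ℚ
  W = ΣAt E y
  C : Subset n
  C = positiveLevelNodes lv
  αβ² : ℕ
  αβ² = α f ℕ.* β ℕ.* β
  y≥0 : ∀ i → 0ℚ ≤ y i
  y≥0 i = invPow-nonNeg (edgeLevel lv (E i))
  level0-underloaded : ∀ v → lv v ≡ zero → W v < 1ℚ
  level0-underloaded v lv≡0 = ℚ.≤-<-trans (level0 v lv≡0) invPow2<1
  W≤1 : ∀ v → W v ≤ 1ℚ
  W≤1 v with lv v Fin.≟ zero
  ... | yes lv≡0 = ℚ.<⇒≤ (level0-underloaded v lv≡0)
  ... | no lv≢0  = ℚ.<⇒≤ (proj₂ (positive-level v lv≢0))
  covers : IsVertexCover E C
  covers = positiveLevelNodes-cover E lv nonempty level0-underloaded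
  ∣C∣≤c*y : fromℕ ∣ C ∣ ≤ fromℕ (approxFactor f) * size y
  ∣C∣≤c*y = subst (λ c → fromℕ ∣ C ∣ ≤ fromℕ c * size y) (sym (approxFactor≡f*αβ² f))
    (∣C∣≤f*A*size E y≥0 ∣E∣≤f αβ² C (λ v∈C → proj₁ (positive-level _ (∈positiveLevelNodes⁻ lv v∈C))))
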